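{- Define polynomials $P_n(X)\in\mathbb{Z}[X]$ by $P_0(X)=1$ and $P_n(X)=XP_{n-1}(X)-P_{n-1}(X+1)$ for $n\ge 1$, and let $f(n)=\sum_{j=0}^{n}(-1)^{j}S(n,j)$. Then for every integer $n\ge 0$: (i) $f(n)=P_n(0)$; (ii) $P_n(X)=\sum_{j=0}^{n}\binom{n}{j}f(n-j)X^{j}$; (iii) $-f(n+1)=\sum_{j=0}^{n}\binom{n}{j}f(n-j)$.
   Context: $S(n,k)$ denotes the Stirling number of the second kind (number of partitions of an $n$-element set into $k$ nonempty blocks, $S(0,0)=1$). -}

module Defs where

open import Data.Nat as ℕ using (ℕ; zero; suc)
open import Data.Integer using (ℤ; +_; 0ℤ; 1ℤ; _+_; _-_; _*_; -_)
open import Data.List using (List; []; _∷_)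

S : ℕ → ℕ → ℕ
S zero    zero    = 1
S zero    (suc k) = 0
S (suc n) zero    = 0
S (suc n) (suc k) = suc k ℕ.* S n (suc k) ℕ.+ S n k

sgn : ℕ → ℤ
sgn zero    = 1ℤ
sgn (suc j) = - sgn j

sumTo : ℕ → (ℕ → ℤ) → ℤ
sumTo zero    g = g zero
sumTo (suc m) g = sumTo m g + g (suc m)

f : ℕ → ℤ
f n = sumTo n (λ j → sgn j * + S n j)

-- Polynomials in ℤ[X] as coefficient lists, lowest degree first
-- (trailing zeros allowed; equality of polynomials = equality of all coefficients).
Poly : Set
Poly = List ℤ

coeff : Poly → ℕ → ℤ
coeff []      _       = 0ℤ
coeff (a ∷ p) zero    = a
coeff (a ∷ p) (suc j) = coeff p j

_⊕_ : Poly → Poly → Poly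
[]      ⊕ q       = q
(a ∷ p) ⊕ []      = a ∷ p
(a ∷ p) ⊕ (b ∷ q) = (a + b) ∷ (p ⊕ q)

neg : Poly → Poly
neg []      = []
neg (a ∷ p) = (- a) ∷ neg p

mulX : Poly → Poly
mulX p = 0ℤ ∷ p

-- p(X) ↦ p(X+1), by Horner: (a + X q)(X+1) = a + (X+1) q(X+1)
shift : Poly → Poly
shift []      = []
shift (a ∷ p) = (a ∷ []) ⊕ (mulX q ⊕ q)
  where q = shift p

eval0 : Poly → ℤ
eval0 p = coeff p zero

P : ℕ → Poly
P zero    = 1ℤ ∷ []
P (suc n) = mulX (P n) ⊕ neg (shift (P n))

-- Part (iii) is the alternating sum of the Stirling convolution
-- S(n+1,k+1) = Σ_i C(n,i) S(i,k).  Part (ii) goes by induction on n: the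
-- coefficient of X^j in P_n(X+1) is Σ_k C(k,j) C(n,k) f(n-k), and the
-- subset-of-a-subset identity C(k,j) C(n,k) = C(n,j) C(n-j,k-j) turns it into
-- C(n,j) times the sum in (iii) for n-j, i.e. into -C(n,j) f(n-j+1); Pascal's
-- rule then yields the coefficients of P_{n+1}.  Part (i) is the case j = 0.
module Submission where

open import Defs
open import Data.Nat using (ℕ; suc; _≤_; _∸_; _>_)
open import Data.Nat.Combinatorics using (_C_)
open import Data.Integer using (ℤ; +_; 0ℤ; _*_; -_)
open import Data.Product using (_×_)
open import Relation.Binary.PropositionalEquality using (_≡_)

open import Data.Nat as ℕ using (zero; _<_; z≤n; s≤s; _!)
import Data.Nat.Properties as ℕP
open import Data.Nat.Combinatorics
  using (nCk+nC[k+1]≡[n+1]C[k+1]; k>n⇒nCk≡0; nCk≡nC[n∸k]; nCk≡n!/k![n-k]!; k![n∸k]!∣n!)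
open import Data.Nat.DivMod using (_/_; m/n*n≡m)
import Data.Nat.Tactic.RingSolver as ℕ-Ring
open import Data.Integer using (_+_)
import Data.Integer.Properties as ℤP
open import Data.Integer.Tactic.RingSolver using (solve-∀)
open import Data.List using ([]; _∷_; length)
open import Data.Product using (_,_)
open import Data.Sum using (inj₁; inj₂)
open import Relation.Binary.PropositionalEquality
  using (refl; sym; trans; cong; cong₂; module ≡-Reasoning)
open import Relation.Nullary using (yes; no)

-- Finite sums

sumTo-cong : ∀ n {g h : ℕ → ℤ} → (∀ j → j ≤ n → g j ≡ h j) → sumTo n g ≡ sumTo n h
sumTo-cong zero    g≡h = g≡h 0 z≤n
sumTo-cong (suc n) g≡h =
  cong₂ _+_ (sumTo-cong n (λ j j≤n → g≡h j (ℕP.m≤n⇒m≤1+n j≤n))) (g≡h (suc n) ℕP.≤-refl)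

sumTo-zero : ∀ n {g : ℕ → ℤ} → (∀ j → j ≤ n → g j ≡ 0ℤ) → sumTo n g ≡ 0ℤ
sumTo-zero zero    g≡0 = g≡0 0 z≤n
sumTo-zero (suc n) g≡0 =
  cong₂ _+_ (sumTo-zero n (λ j j≤n → g≡0 j (ℕP.m≤n⇒m≤1+n j≤n))) (g≡0 (suc n) ℕP.≤-refl)

sumTo-+ : ∀ n (g h : ℕ → ℤ) → sumTo n (λ j → g j + h j) ≡ sumTo n g + sumTo n h
sumTo-+ zero    g h = refl
sumTo-+ (suc n) g h =
  trans (cong (_+ (g (suc n) + h (suc n))) (sumTo-+ n g h))
        (interchange (sumTo n g) (sumTo n h) (g (suc n)) (h (suc n)))
  where
  interchange : ∀ a b c d → a + b + (c + d) ≡ a + c + (b + d)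
  interchange = solve-∀

sumTo-*ˡ : ∀ n c (g : ℕ → ℤ) → sumTo n (λ j → c * g j) ≡ c * sumTo n g
sumTo-*ˡ zero    c g = refl
sumTo-*ˡ (suc n) c g =
  trans (cong (_+ (c * g (suc n))) (sumTo-*ˡ n c g))
        (sym (ℤP.*-distribˡ-+ c (sumTo n g) (g (suc n))))

sumTo-neg : ∀ n (g : ℕ → ℤ) → sumTo n (λ j → - g j) ≡ - sumTo n g
sumTo-neg zero    g = refl
sumTo-neg (suc n) g =
  trans (cong (_+ - g (suc n)) (sumTo-neg n g)) (sym (ℤP.neg-distrib-+ (sumTo n g) (g (suc n))))

sumTo-suc : ∀ n (g : ℕ → ℤ) → sumTo (suc n) g ≡ g 0 + sumTo n (λ j → g (suc j))
sumTo-suc zero    g = refl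
sumTo-suc (suc n) g =
  trans (cong (_+ g (suc (suc n))) (sumTo-suc n g))
        (ℤP.+-assoc (g 0) (sumTo n (λ j → g (suc j))) (g (suc (suc n))))

sumTo-swap : ∀ m n (a : ℕ → ℕ → ℤ) →
  sumTo m (λ k → sumTo n (λ i → a k i)) ≡ sumTo n (λ i → sumTo m (λ k → a k i))
sumTo-swap zero    n a = refl
sumTo-swap (suc m) n a =
  trans (cong (_+ sumTo n (a (suc m))) (sumTo-swap m n a))
        (sym (sumTo-+ n (λ i → sumTo m (λ k → a k i)) (a (suc m))))

sumTo-reverse : ∀ n (g : ℕ → ℤ) → sumTo n g ≡ sumTo n (λ j → g (n ∸ j))
sumTo-reverse zero    g = refl
sumTo-reverse (suc n) g = begin
  sumTo (suc n) g                                 ≡⟨ sumTo-suc n g ⟩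
  g 0 + sumTo n (λ j → g (suc j))                 ≡⟨ cong (_+_ (g 0)) (sumTo-reverse n (λ j → g (suc j))) ⟩
  g 0 + sumTo n (λ j → g (suc (n ∸ j)))           ≡⟨ ℤP.+-comm (g 0) _ ⟩
  sumTo n (λ j → g (suc (n ∸ j))) + g 0           ≡⟨ cong₂ _+_ (sumTo-cong n (λ j j≤n → cong g (sym (ℕP.+-∸-assoc 1 j≤n))))
                                                               (cong g (sym (ℕP.n∸n≡0 n))) ⟩
  sumTo n (λ j → g (suc n ∸ j)) + g (suc n ∸ suc n) ∎
  where open ≡-Reasoning

sumTo-vanishing-≤ : ∀ {N} M {g : ℕ → ℤ} → N ≤ M → (∀ k → N < k → g k ≡ 0ℤ) →
  sumTo M g ≡ sumTo N g
sumTo-vanishing-≤ zero    z≤n      g≡0 = refl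
sumTo-vanishing-≤ (suc M) N≤1+M g≡0 with ℕP.m≤n⇒m<n∨m≡n N≤1+M
... | inj₂ refl      = refl
... | inj₁ (s≤s N≤M) =
  trans (cong₂ _+_ (sumTo-vanishing-≤ M N≤M g≡0) (g≡0 (suc M) (s≤s N≤M)))
        (ℤP.+-identityʳ _)

sumTo-support : ∀ {N M} {g : ℕ → ℤ} →
  (∀ k → N < k → g k ≡ 0ℤ) → (∀ k → M < k → g k ≡ 0ℤ) → sumTo N g ≡ sumTo M g
sumTo-support {N} {M} gN≡0 gM≡0 with ℕP.≤-total N M
... | inj₁ N≤M = sym (sumTo-vanishing-≤ M N≤M gN≡0)
... | inj₂ M≤N = sumTo-vanishing-≤ N M≤N gM≡0

sumTo-dropInitial : ∀ j m {g : ℕ → ℤ} → (∀ k → k < j → g k ≡ 0ℤ) →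
  sumTo (j ℕ.+ m) g ≡ sumTo m (λ i → g (j ℕ.+ i))
sumTo-dropInitial zero    m     g≡0 = refl
sumTo-dropInitial (suc j) m {g} g≡0 = begin
  sumTo (suc j ℕ.+ m) g                          ≡⟨ sumTo-suc (j ℕ.+ m) g ⟩
  g 0 + sumTo (j ℕ.+ m) (λ k → g (suc k))        ≡⟨ cong₂ _+_ (g≡0 0 (s≤s z≤n))
                                                              (sumTo-dropInitial j m (λ k k<j → g≡0 (suc k) (s≤s k<j))) ⟩
  0ℤ + sumTo m (λ i → g (suc j ℕ.+ i))           ≡⟨ ℤP.+-identityˡ _ ⟩
  sumTo m (λ i → g (suc j ℕ.+ i))                ∎
  where open ≡-Reasoning

-- Binomial coefficients

pascal : ∀ n k → + (suc n C suc k) ≡ + (n C k) + + (n C suc k)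
pascal n k = trans (cong +_ (sym (nCk+nC[k+1]≡[n+1]C[k+1] n k))) (ℤP.pos-+ (n C k) (n C suc k))

C*-vanishing : ∀ {n k} x → n < k → + (n C k) * x ≡ 0ℤ
C*-vanishing x n<k = cong (λ c → + c * x) (k>n⇒nCk≡0 n<k)

C*!*!≡! : ∀ a b → ((a ℕ.+ b) C a) ℕ.* (a ! ℕ.* b !) ≡ (a ℕ.+ b) !
C*!*!≡! a b = begin
  ((a ℕ.+ b) C a) ℕ.* (a ! ℕ.* b !)                  ≡⟨ cong (λ x → ((a ℕ.+ b) C a) ℕ.* (a ! ℕ.* x !)) (sym (ℕP.m+n∸m≡n a b)) ⟩
  ((a ℕ.+ b) C a) ℕ.* (a ! ℕ.* (a ℕ.+ b ∸ a) !)      ≡⟨ cong (ℕ._* (a ! ℕ.* (a ℕ.+ b ∸ a) !)) (nCk≡n!/k![n-k]! a≤a+b) ⟩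
  (a ℕ.+ b) ! / (a ! ℕ.* (a ℕ.+ b ∸ a) !) ℕ.* (a ! ℕ.* (a ℕ.+ b ∸ a) !) ≡⟨ m/n*n≡m (k![n∸k]!∣n! a≤a+b) ⟩
  (a ℕ.+ b) !                                        ∎
  where
  open ≡-Reasoning
  a≤a+b : a ≤ a ℕ.+ b
  a≤a+b = ℕP.m≤m+n a b
  instance
    !*!≢0 : ℕ.NonZero (a ! ℕ.* (a ℕ.+ b ∸ a) !)
    !*!≢0 = ℕP._!*_!≢0 a (a ℕ.+ b ∸ a)

C*C-subset : ∀ j i r →
  ((j ℕ.+ i) C j) ℕ.* ((j ℕ.+ i ℕ.+ r) C (j ℕ.+ i)) ≡ ((j ℕ.+ (i ℕ.+ r)) C j) ℕ.* ((i ℕ.+ r) C i)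
-- Both sides, multiplied by j! i! r!, equal (j+i+r)!.
C*C-subset j i r = ℕP.*-cancelʳ-≡ _ _ (j ! ℕ.* (i ! ℕ.* r !)) {{D≢0}} (trans lhs (sym rhs))
  where
  open ≡-Reasoning
  D≢0 : ℕ.NonZero (j ! ℕ.* (i ! ℕ.* r !))
  D≢0 = ℕP.m*n≢0 (j !) (i ! ℕ.* r !) {{ℕP._!≢0 j}} {{ℕP._!*_!≢0 i r}}
  regroupˡ : ∀ a b x y z → a ℕ.* b ℕ.* (x ℕ.* (y ℕ.* z)) ≡ b ℕ.* ((a ℕ.* (x ℕ.* y)) ℕ.* z)
  regroupˡ = ℕ-Ring.solve-∀
  regroupʳ : ∀ a b x y z → a ℕ.* b ℕ.* (x ℕ.* (y ℕ.* z)) ≡ a ℕ.* (x ℕ.* (b ℕ.* (y ℕ.* z)))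
  regroupʳ = ℕ-Ring.solve-∀
  lhs : ((j ℕ.+ i) C j) ℕ.* ((j ℕ.+ i ℕ.+ r) C (j ℕ.+ i)) ℕ.* (j ! ℕ.* (i ! ℕ.* r !)) ≡ (j ℕ.+ (i ℕ.+ r)) !
  lhs = begin
    ((j ℕ.+ i) C j) ℕ.* ((j ℕ.+ i ℕ.+ r) C (j ℕ.+ i)) ℕ.* (j ! ℕ.* (i ! ℕ.* r !))
      ≡⟨ regroupˡ ((j ℕ.+ i) C j) ((j ℕ.+ i ℕ.+ r) C (j ℕ.+ i)) (j !) (i !) (r !) ⟩
    ((j ℕ.+ i ℕ.+ r) C (j ℕ.+ i)) ℕ.* ((((j ℕ.+ i) C j) ℕ.* (j ! ℕ.* i !)) ℕ.* r !)
      ≡⟨ cong (λ x → ((j ℕ.+ i ℕ.+ r) C (j ℕ.+ i)) ℕ.* (x ℕ.* r !)) (C*!*!≡! j i) ⟩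
    ((j ℕ.+ i ℕ.+ r) C (j ℕ.+ i)) ℕ.* ((j ℕ.+ i) ! ℕ.* r !)
      ≡⟨ C*!*!≡! (j ℕ.+ i) r ⟩
    (j ℕ.+ i ℕ.+ r) !
      ≡⟨ cong _! (ℕP.+-assoc j i r) ⟩
    (j ℕ.+ (i ℕ.+ r)) ! ∎
  rhs : ((j ℕ.+ (i ℕ.+ r)) C j) ℕ.* ((i ℕ.+ r) C i) ℕ.* (j ! ℕ.* (i ! ℕ.* r !)) ≡ (j ℕ.+ (i ℕ.+ r)) !
  rhs = begin
    ((j ℕ.+ (i ℕ.+ r)) C j) ℕ.* ((i ℕ.+ r) C i) ℕ.* (j ! ℕ.* (i ! ℕ.* r !))
      ≡⟨ regroupʳ ((j ℕ.+ (i ℕ.+ r)) C j) ((i ℕ.+ r) C i) (j !) (i !) (r !) ⟩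
    ((j ℕ.+ (i ℕ.+ r)) C j) ℕ.* (j ! ℕ.* (((i ℕ.+ r) C i) ℕ.* (i ! ℕ.* r !)))
      ≡⟨ cong (λ x → ((j ℕ.+ (i ℕ.+ r)) C j) ℕ.* (j ! ℕ.* x)) (C*!*!≡! i r) ⟩
    ((j ℕ.+ (i ℕ.+ r)) C j) ℕ.* (j ! ℕ.* (i ℕ.+ r) !)
      ≡⟨ C*!*!≡! j (i ℕ.+ r) ⟩
    (j ℕ.+ (i ℕ.+ r)) ! ∎

C*C-subset-≤ : ∀ j m i → i ≤ m →
  + ((j ℕ.+ i) C j) * + ((j ℕ.+ m) C (j ℕ.+ i)) ≡ + ((j ℕ.+ m) C j) * + (m C i)
C*C-subset-≤ j m i i≤m with ℕP.m≤n⇒∃[o]m+o≡n i≤m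
... | r , refl = begin
  + ((j ℕ.+ i) C j) * + ((j ℕ.+ (i ℕ.+ r)) C (j ℕ.+ i))   ≡⟨ sym (ℤP.pos-* ((j ℕ.+ i) C j) _) ⟩
  + (((j ℕ.+ i) C j) ℕ.* ((j ℕ.+ (i ℕ.+ r)) C (j ℕ.+ i))) ≡⟨ cong (λ x → + (((j ℕ.+ i) C j) ℕ.* (x C (j ℕ.+ i)))) (sym (ℕP.+-assoc j i r)) ⟩
  + (((j ℕ.+ i) C j) ℕ.* ((j ℕ.+ i ℕ.+ r) C (j ℕ.+ i)))   ≡⟨ cong +_ (C*C-subset j i r) ⟩
  + (((j ℕ.+ (i ℕ.+ r)) C j) ℕ.* ((i ℕ.+ r) C i))         ≡⟨ ℤP.pos-* ((j ℕ.+ (i ℕ.+ r)) C j) _ ⟩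
  + ((j ℕ.+ (i ℕ.+ r)) C j) * + ((i ℕ.+ r) C i)           ∎
  where open ≡-Reasoning

-- Coefficients of polynomials

coeff-⊕ : ∀ p q j → coeff (p ⊕ q) j ≡ coeff p j + coeff q j
coeff-⊕ []      q       j       = sym (ℤP.+-identityˡ _)
coeff-⊕ (a ∷ p) []      j       = sym (ℤP.+-identityʳ _)
coeff-⊕ (a ∷ p) (b ∷ q) zero    = refl
coeff-⊕ (a ∷ p) (b ∷ q) (suc j) = coeff-⊕ p q j

coeff-neg : ∀ p j → coeff (neg p) j ≡ - coeff p j
coeff-neg []      j       = refl
coeff-neg (a ∷ p) zero    = refl
coeff-neg (a ∷ p) (suc j) = coeff-neg p j

coeff-≥length : ∀ p {k} → length p ≤ k → coeff p k ≡ 0ℤ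
coeff-≥length []      _         = refl
coeff-≥length (a ∷ p) (s≤s L≤k) = coeff-≥length p L≤k

coeff-shift : ∀ p j → coeff (shift p) j ≡ sumTo (length p) (λ k → + (k C j) * coeff p k)
coeff-shift []      j       = sym (ℤP.*-zeroʳ (+ (0 C j)))
coeff-shift (a ∷ p) zero    = begin
  coeff ((a ∷ []) ⊕ (mulX (shift p) ⊕ shift p)) 0     ≡⟨ coeff-⊕ (a ∷ []) (mulX (shift p) ⊕ shift p) 0 ⟩
  a + coeff (mulX (shift p) ⊕ shift p) 0              ≡⟨ cong (_+_ a) (trans (coeff-⊕ (mulX (shift p)) (shift p) 0) (ℤP.+-identityˡ _)) ⟩
  a + coeff (shift p) 0                               ≡⟨ cong₂ _+_ (sym (ℤP.*-identityˡ a)) (coeff-shift p 0) ⟩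
  + 1 * a + sumTo (length p) (λ k → + 1 * coeff p k)  ≡⟨ sym (sumTo-suc (length p) _) ⟩
  sumTo (length (a ∷ p)) (λ k → + (k C 0) * coeff (a ∷ p) k) ∎
  where open ≡-Reasoning
coeff-shift (a ∷ p) (suc j) = begin
  coeff ((a ∷ []) ⊕ (mulX (shift p) ⊕ shift p)) (suc j)
    ≡⟨ trans (coeff-⊕ (a ∷ []) (mulX (shift p) ⊕ shift p) (suc j)) (ℤP.+-identityˡ _) ⟩
  coeff (mulX (shift p) ⊕ shift p) (suc j)
    ≡⟨ coeff-⊕ (mulX (shift p)) (shift p) (suc j) ⟩
  coeff (shift p) j + coeff (shift p) (suc j)
    ≡⟨ cong₂ _+_ (coeff-shift p j) (coeff-shift p (suc j)) ⟩
  sumTo L (λ k → + (k C j) * coeff p k) + sumTo L (λ k → + (k C suc j) * coeff p k)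
    ≡⟨ sym (sumTo-+ L _ _) ⟩
  sumTo L (λ k → + (k C j) * coeff p k + + (k C suc j) * coeff p k)
    ≡⟨ sumTo-cong L (λ k _ → pascal-term k) ⟩
  sumTo L (λ k → + (suc k C suc j) * coeff p k)
    ≡⟨ sym (ℤP.+-identityˡ _) ⟩
  0ℤ * a + sumTo L (λ k → + (suc k C suc j) * coeff p k)
    ≡⟨ sym (sumTo-suc L _) ⟩
  sumTo (length (a ∷ p)) (λ k → + (k C suc j) * coeff (a ∷ p) k) ∎
  where
  open ≡-Reasoning
  L : ℕ
  L = length p
  pascal-term : ∀ k → + (k C j) * coeff p k + + (k C suc j) * coeff p k ≡ + (suc k C suc j) * coeff p k
  pascal-term k = trans (sym (ℤP.*-distribʳ-+ (coeff p k) (+ (k C j)) (+ (k C suc j))))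
                        (cong (_* coeff p k) (sym (pascal k j)))

coeff-shift-bounded : ∀ p n → (∀ k → n < k → coeff p k ≡ 0ℤ) →
  ∀ j → coeff (shift p) j ≡ sumTo n (λ k → + (k C j) * coeff p k)
coeff-shift-bounded p n p≡0 j =
  trans (coeff-shift p j)
        (sumTo-support (λ k L<k → vanish (coeff-≥length p (ℕP.<⇒≤ L<k)))
                       (λ k n<k → vanish (p≡0 k n<k)))
  where
  vanish : ∀ {k} → coeff p k ≡ 0ℤ → + (k C j) * coeff p k ≡ 0ℤ
  vanish {k} c≡0 = trans (cong (+ (k C j) *_) c≡0) (ℤP.*-zeroʳ (+ (k C j)))

-- Binomial transforms and the Stirling convolution

binomial : (ℕ → ℤ) → ℕ → ℤ
binomial a n = sumTo n (λ i → + (n C i) * a i)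

binomial-suc : ∀ (a : ℕ → ℤ) n → binomial a (suc n) ≡ binomial a n + binomial (λ i → a (suc i)) n
binomial-suc a n = begin
  binomial a (suc n)                              ≡⟨ sumTo-suc n _ ⟩
  + 1 * a 0 + sumTo n (λ i → + (suc n C suc i) * a (suc i))
    ≡⟨ cong (_+_ (+ 1 * a 0)) (trans (sumTo-cong n (λ i _ → pascal-term i)) (sumTo-+ n _ _)) ⟩
  + 1 * a 0 + (binomial (λ i → a (suc i)) n + B)  ≡⟨ regroup (+ 1 * a 0) (binomial (λ i → a (suc i)) n) B ⟩
  (+ 1 * a 0 + B) + binomial (λ i → a (suc i)) n  ≡⟨ cong (_+ binomial (λ i → a (suc i)) n) (sym binomial-peel) ⟩
  binomial a n + binomial (λ i → a (suc i)) n     ∎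
  where
  open ≡-Reasoning
  B : ℤ
  B = sumTo n (λ i → + (n C suc i) * a (suc i))
  pascal-term : ∀ i → + (suc n C suc i) * a (suc i) ≡ + (n C i) * a (suc i) + + (n C suc i) * a (suc i)
  pascal-term i = trans (cong (_* a (suc i)) (pascal n i)) (ℤP.*-distribʳ-+ (a (suc i)) (+ (n C i)) (+ (n C suc i)))
  regroup : ∀ x y z → x + (y + z) ≡ x + z + y
  regroup = solve-∀
  binomial-peel : binomial a n ≡ + 1 * a 0 + B
  binomial-peel =
    trans (sym (sumTo-vanishing-≤ (suc n) (ℕP.n≤1+n n)
                 (λ k n<k → C*-vanishing (a k) n<k)))
          (sumTo-suc n _)

binomial-linear : ∀ c (a b : ℕ → ℤ) n →
  binomial (λ i → c * a i + b i) n ≡ c * binomial a n + binomial b n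
binomial-linear c a b n = begin
  binomial (λ i → c * a i + b i) n
    ≡⟨ sumTo-cong n (λ i _ → distribute (+ (n C i)) c (a i) (b i)) ⟩
  sumTo n (λ i → c * (+ (n C i) * a i) + + (n C i) * b i)
    ≡⟨ sumTo-+ n _ _ ⟩
  sumTo n (λ i → c * (+ (n C i) * a i)) + binomial b n
    ≡⟨ cong (_+ binomial b n) (sumTo-*ˡ n c _) ⟩
  c * binomial a n + binomial b n ∎
  where
  open ≡-Reasoning
  distribute : ∀ d c x y → d * (c * x + y) ≡ c * (d * x) + d * y
  distribute = solve-∀

S-suc-suc : ∀ n k → + S (suc n) (suc k) ≡ + suc k * + S n (suc k) + + S n k
S-suc-suc n k = trans (ℤP.pos-+ (suc k ℕ.* S n (suc k)) (S n k))
                      (cong (_+ + S n k) (ℤP.pos-* (suc k) (S n (suc k))))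

S-convolution : ∀ n k → + S (suc n) (suc k) ≡ binomial (λ i → + S i k) n
S-convolution zero    zero    = refl
S-convolution zero    (suc k) = cong +_ (trans (ℕP.+-identityʳ _) (ℕP.*-zeroʳ (suc (suc k))))
S-convolution (suc n) k = begin
  + S (suc (suc n)) (suc k)                                ≡⟨ S-suc-suc (suc n) k ⟩
  + suc k * + S (suc n) (suc k) + + S (suc n) k            ≡⟨ peel (+ k) (+ S (suc n) (suc k)) (+ S (suc n) k) ⟩
  + S (suc n) (suc k) + (+ k * + S (suc n) (suc k) + + S (suc n) k)
    ≡⟨ cong₂ _+_ (S-convolution n k) (sym (binomial-S-suc k)) ⟩
  binomial (λ i → + S i k) n + binomial (λ i → + S (suc i) k) n ≡⟨ sym (binomial-suc (λ i → + S i k) n) ⟩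
  binomial (λ i → + S i k) (suc n)                         ∎
  where
  open ≡-Reasoning
  peel : ∀ c x y → (+ 1 + c) * x + y ≡ x + (c * x + y)
  peel = solve-∀
  binomial-S-suc : ∀ k → binomial (λ i → + S (suc i) k) n ≡ + k * + S (suc n) (suc k) + + S (suc n) k
  binomial-S-suc zero     = sumTo-zero n (λ i _ → ℤP.*-zeroʳ (+ (n C i)))
  binomial-S-suc (suc k′) = begin
    binomial (λ i → + S (suc i) (suc k′)) n
      ≡⟨ sumTo-cong n (λ i _ → cong (+ (n C i) *_) (S-suc-suc i k′)) ⟩
    binomial (λ i → + suc k′ * + S i (suc k′) + + S i k′) n
      ≡⟨ binomial-linear (+ suc k′) _ _ n ⟩
    + suc k′ * binomial (λ i → + S i (suc k′)) n + binomial (λ i → + S i k′) n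
      ≡⟨ cong₂ (λ x y → + suc k′ * x + y) (sym (S-convolution n (suc k′))) (sym (S-convolution n k′)) ⟩
    + suc k′ * + S (suc n) (suc (suc k′)) + + S (suc n) (suc k′) ∎

binomial-reflect : ∀ (a : ℕ → ℤ) n → binomial a n ≡ sumTo n (λ j → + (n C j) * a (n ∸ j))
binomial-reflect a n =
  trans (sumTo-reverse n _)
        (sumTo-cong n (λ j j≤n → cong (λ c → + c * a (n ∸ j)) (sym (nCk≡nC[n∸k] j≤n))))

sumTo-*-binomial : ∀ m n (c : ℕ → ℤ) (a : ℕ → ℕ → ℤ) →
  sumTo m (λ k → c k * binomial (a k) n) ≡ binomial (λ i → sumTo m (λ k → c k * a k i)) n
sumTo-*-binomial m n c a = begin
  sumTo m (λ k → c k * binomial (a k) n)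
    ≡⟨ sumTo-cong m (λ k _ → sym (sumTo-*ˡ n (c k) _)) ⟩
  sumTo m (λ k → sumTo n (λ i → c k * (+ (n C i) * a k i)))
    ≡⟨ sumTo-swap m n _ ⟩
  sumTo n (λ i → sumTo m (λ k → c k * (+ (n C i) * a k i)))
    ≡⟨ sumTo-cong n (λ i _ → trans (sumTo-cong m (λ k _ → commute (c k) (+ (n C i)) (a k i)))
                                   (sumTo-*ˡ m (+ (n C i)) _)) ⟩
  binomial (λ i → sumTo m (λ k → c k * a k i)) n ∎
  where
  open ≡-Reasoning
  commute : ∀ x y z → x * (y * z) ≡ y * (x * z)
  commute = solve-∀

S-vanishing : ∀ {n k} → n < k → S n k ≡ 0
S-vanishing {zero}  {suc k} _         = refl
S-vanishing {suc n} {suc k} (s≤s n<k) =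
  cong₂ ℕ._+_ (trans (cong (suc k ℕ.*_) (S-vanishing (ℕP.m≤n⇒m≤1+n n<k))) (ℕP.*-zeroʳ (suc k)))
              (S-vanishing n<k)

f-≤ : ∀ {i} M → i ≤ M → sumTo M (λ k → sgn k * + S i k) ≡ f i
f-≤ M i≤M = sumTo-vanishing-≤ M i≤M
  (λ k i<k → trans (cong (λ s → sgn k * + s) (S-vanishing i<k)) (ℤP.*-zeroʳ (sgn k)))

neg-f-suc : ∀ n → - f (suc n) ≡ sumTo n (λ k → sgn k * + S (suc n) (suc k))
neg-f-suc n = begin
  - f (suc n)                                                    ≡⟨ cong -_ (sumTo-suc n _) ⟩
  - (0ℤ + sumTo n (λ k → - sgn k * + S (suc n) (suc k)))         ≡⟨ cong -_ (ℤP.+-identityˡ _) ⟩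
  - sumTo n (λ k → - sgn k * + S (suc n) (suc k))                ≡⟨ cong -_ (sumTo-cong n (λ k _ → sym (ℤP.neg-distribˡ-* (sgn k) _))) ⟩
  - sumTo n (λ k → - (sgn k * + S (suc n) (suc k)))              ≡⟨ cong -_ (sumTo-neg n _) ⟩
  - - sumTo n (λ k → sgn k * + S (suc n) (suc k))                ≡⟨ ℤP.neg-involutive _ ⟩
  sumTo n (λ k → sgn k * + S (suc n) (suc k))                    ∎
  where open ≡-Reasoning

f-recurrence : ∀ n → - f (suc n) ≡ sumTo n (λ j → + (n C j) * f (n ∸ j))
f-recurrence n = begin
  - f (suc n)                                          ≡⟨ neg-f-suc n ⟩
  sumTo n (λ k → sgn k * + S (suc n) (suc k))          ≡⟨ sumTo-cong n (λ k _ → cong (sgn k *_) (S-convolution n k)) ⟩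
  sumTo n (λ k → sgn k * binomial (λ i → + S i k) n)   ≡⟨ sumTo-*-binomial n n sgn (λ k i → + S i k) ⟩
  binomial (λ i → sumTo n (λ k → sgn k * + S i k)) n   ≡⟨ sumTo-cong n (λ i i≤n → cong (+ (n C i) *_) (f-≤ n i≤n)) ⟩
  binomial f n                                         ≡⟨ binomial-reflect f n ⟩
  sumTo n (λ j → + (n C j) * f (n ∸ j))                ∎
  where open ≡-Reasoning

sumTo-kCj*nCk*f[n∸k] : ∀ n j →
  sumTo n (λ k → + (k C j) * (+ (n C k) * f (n ∸ k))) ≡ - (+ (n C j) * f (suc n ∸ j))
sumTo-kCj*nCk*f[n∸k] n j with j ℕP.≤? n
... | no j≰n = trans (sumTo-zero n (λ k k≤n → C*-vanishing (+ (n C k) * f (n ∸ k)) (ℕP.≤-<-trans k≤n n<j)))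
                     (cong -_ (sym (C*-vanishing (f (suc n ∸ j)) n<j)))
  where
  n<j : n < j
  n<j = ℕP.≰⇒> j≰n
... | yes j≤n with ℕP.m≤n⇒∃[o]m+o≡n j≤n
... | m , refl = begin
  sumTo (j ℕ.+ m) (λ k → + (k C j) * (+ ((j ℕ.+ m) C k) * f (j ℕ.+ m ∸ k)))
    ≡⟨ sumTo-dropInitial j m (λ k k<j → C*-vanishing (+ ((j ℕ.+ m) C k) * f (j ℕ.+ m ∸ k)) k<j) ⟩
  sumTo m (λ i → + ((j ℕ.+ i) C j) * (+ ((j ℕ.+ m) C (j ℕ.+ i)) * f (j ℕ.+ m ∸ (j ℕ.+ i))))
    ≡⟨ sumTo-cong m (λ i i≤m → subset-term i i≤m) ⟩
  sumTo m (λ i → + ((j ℕ.+ m) C j) * (+ (m C i) * f (m ∸ i)))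
    ≡⟨ sumTo-*ˡ m (+ ((j ℕ.+ m) C j)) _ ⟩
  + ((j ℕ.+ m) C j) * sumTo m (λ i → + (m C i) * f (m ∸ i))
    ≡⟨ cong (+ ((j ℕ.+ m) C j) *_) (sym (f-recurrence m)) ⟩
  + ((j ℕ.+ m) C j) * - f (suc m)
    ≡⟨ sym (ℤP.neg-distribʳ-* (+ ((j ℕ.+ m) C j)) (f (suc m))) ⟩
  - (+ ((j ℕ.+ m) C j) * f (suc m))
    ≡⟨ cong (λ k → - (+ ((j ℕ.+ m) C j) * f k)) (sym suc[j+m]∸j≡1+m) ⟩
  - (+ ((j ℕ.+ m) C j) * f (suc (j ℕ.+ m) ∸ j)) ∎
  where
  open ≡-Reasoning
  suc[j+m]∸j≡1+m : suc (j ℕ.+ m) ∸ j ≡ suc m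
  suc[j+m]∸j≡1+m = trans (cong (_∸ j) (sym (ℕP.+-suc j m))) (ℕP.m+n∸m≡n j (suc m))
  subset-term : ∀ i → i ≤ m →
    + ((j ℕ.+ i) C j) * (+ ((j ℕ.+ m) C (j ℕ.+ i)) * f (j ℕ.+ m ∸ (j ℕ.+ i)))
      ≡ + ((j ℕ.+ m) C j) * (+ (m C i) * f (m ∸ i))
  subset-term i i≤m = begin
    + ((j ℕ.+ i) C j) * (+ ((j ℕ.+ m) C (j ℕ.+ i)) * f (j ℕ.+ m ∸ (j ℕ.+ i)))
      ≡⟨ cong (λ k → + ((j ℕ.+ i) C j) * (+ ((j ℕ.+ m) C (j ℕ.+ i)) * f k)) (ℕP.[m+n]∸[m+o]≡n∸o j m i) ⟩
    + ((j ℕ.+ i) C j) * (+ ((j ℕ.+ m) C (j ℕ.+ i)) * f (m ∸ i))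
      ≡⟨ sym (ℤP.*-assoc (+ ((j ℕ.+ i) C j)) _ _) ⟩
    + ((j ℕ.+ i) C j) * + ((j ℕ.+ m) C (j ℕ.+ i)) * f (m ∸ i)
      ≡⟨ cong (_* f (m ∸ i)) (C*C-subset-≤ j m i i≤m) ⟩
    + ((j ℕ.+ m) C j) * + (m C i) * f (m ∸ i)
      ≡⟨ ℤP.*-assoc (+ ((j ℕ.+ m) C j)) _ _ ⟩
    + ((j ℕ.+ m) C j) * (+ (m C i) * f (m ∸ i)) ∎

coeff-P : ∀ n j → coeff (P n) j ≡ + (n C j) * f (n ∸ j)
coeff-P zero    zero    = refl
coeff-P zero    (suc j) = refl
coeff-P (suc n) j = begin
  coeff (mulX (P n) ⊕ neg (shift (P n))) j                 ≡⟨ coeff-⊕ (mulX (P n)) (neg (shift (P n))) j ⟩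
  coeff (mulX (P n)) j + coeff (neg (shift (P n))) j       ≡⟨ cong (_+_ (coeff (mulX (P n)) j)) (trans (coeff-neg (shift (P n)) j) (cong -_ coeff-shift-P)) ⟩
  coeff (mulX (P n)) j + - - (+ (n C j) * f (suc n ∸ j))   ≡⟨ cong (_+_ (coeff (mulX (P n)) j)) (ℤP.neg-involutive _) ⟩
  coeff (mulX (P n)) j + + (n C j) * f (suc n ∸ j)         ≡⟨ pascal-step j ⟩
  + (suc n C j) * f (suc n ∸ j)                            ∎
  where
  open ≡-Reasoning
  coeff-shift-P : coeff (shift (P n)) j ≡ - (+ (n C j) * f (suc n ∸ j))
  coeff-shift-P =
    trans (coeff-shift-bounded (P n) n (λ k n<k → trans (coeff-P n k) (C*-vanishing (f (n ∸ k)) n<k)) j)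
          (trans (sumTo-cong n (λ k _ → cong (+ (k C j) *_) (coeff-P n k))) (sumTo-kCj*nCk*f[n∸k] n j))
  pascal-step : ∀ j → coeff (mulX (P n)) j + + (n C j) * f (suc n ∸ j) ≡ + (suc n C j) * f (suc n ∸ j)
  pascal-step zero     = ℤP.+-identityˡ _
  pascal-step (suc j′) = begin
    coeff (P n) j′ + + (n C suc j′) * f (n ∸ j′)              ≡⟨ cong (_+ + (n C suc j′) * f (n ∸ j′)) (coeff-P n j′) ⟩
    + (n C j′) * f (n ∸ j′) + + (n C suc j′) * f (n ∸ j′)     ≡⟨ sym (ℤP.*-distribʳ-+ (f (n ∸ j′)) (+ (n C j′)) (+ (n C suc j′))) ⟩
    (+ (n C j′) + + (n C suc j′)) * f (n ∸ j′)                ≡⟨ cong (_* f (n ∸ j′)) (sym (pascal n j′)) ⟩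
    + (suc n C suc j′) * f (n ∸ j′)                           ∎

proposition3p4 : (n : ℕ) →
    (f n ≡ eval0 (P n))
    × ((∀ j → j ≤ n → coeff (P n) j ≡ + (n C j) * f (n ∸ j))
       × (∀ j → j > n → coeff (P n) j ≡ 0ℤ))
    × (- f (suc n) ≡ sumTo n (λ j → + (n C j) * f (n ∸ j)))
proposition3p4 n =
    sym (trans (coeff-P n 0) (ℤP.*-identityˡ (f n)))
  , ((λ j _ → coeff-P n j)
  , (λ j n<j → trans (coeff-P n j) (C*-vanishing (f (n ∸ j)) n<j)))
  , f-recurrence n
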